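{- For every positive integer $n$, $$\sum_{\sigma\in B_n}\prod_{i=1}^n q_i^{d_i(\sigma)+n_i(\sigma^{ -1})}=\sum_{\sigma\in B_n}\prod_{i=1}^n q_i^{2d_i(\sigma)+\varepsilon_i(\sigma)}.$$
   Context: $B_n$ is the group of signed permutations (bijections $\sigma$ of $[-n,n]\setminus\{0\}$ with $\sigma(-a)=-\sigma(a)$). For $\sigma\in B_n$: ${\it Des}(\sigma)=\{i\in[n-1]:\sigma(i)>\sigma(i+1)\}$ (usual order on integers); $d_i(\sigma)=|\{j\in{\it Des}(\sigma):j\ge i\}|$; ${\it Neg}(\sigma)=\{i\in[n]:\sigma(i)<0\}$; $n_i(\sigma)=|\{j\in{\it Neg}(\sigma):j\ge i\}|$; $\varepsilon_i(\sigma)=1$ if $\sigma(i)<0$, else $0$. -}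

module Defs where

open import Level using (Level)
open import Data.Bool using (Bool; true; false; if_then_else_; _∧_; _∨_; not)
open import Data.Nat as ℕ using (ℕ; zero; suc)
open import Data.Fin as Fin using (Fin; toℕ)
open import Data.Fin.Properties using () renaming (_≟_ to _≟ᶠ_)
open import Data.Integer as ℤ using (ℤ; +_; -[1+_])
open import Data.Product using (_×_; _,_; proj₁; proj₂)
open import Data.List using (List; []; _∷_; map; concatMap; filter; length; foldr)
open import Data.Bool.ListAction using (all; any)
open import Data.List.Base using (allFin)
open import Data.Vec.Functional using (Vector) renaming (_∷_ to _∷ᶠ_)
open import Relation.Nullary.Decidable using (⌊_⌋)
open import Algebra.Bundles using (CommutativeSemiring)

-- A candidate signed map σ is given by its values σ(1),…,σ(n); position
-- i ∈ [n] is represented by (i-1) : Fin n, and a value ±k (k ∈ [n]) by the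
-- pair (b , k-1) with b = true iff the value is negative.  σ(-a) = -σ(a)
-- determines σ on negative arguments.  σ is a bijection of [±n] iff the
-- absolute-value part is injective (equivalently a permutation of [n]).

SignedMap : ℕ → Set
SignedMap n = Fin n → Bool × Fin n

val : ∀ {n} → SignedMap n → Fin n → ℤ
val σ i with σ i
... | false , k = + suc (toℕ k)
... | true  , k = -[1+ toℕ k ]

allFuns : ∀ {A : Set} → List A → (m : ℕ) → List (Fin m → A)
allFuns xs zero = (λ ()) ∷ []
allFuns xs (suc m) = concatMap (λ x → map (λ f → x ∷ᶠ f) (allFuns xs m)) xs

isBij : ∀ {n} → SignedMap n → Bool
isBij {n} σ = all (λ i → all (λ j → ⌊ i ≟ᶠ j ⌋ ∨ not ⌊ proj₂ (σ i) ≟ᶠ proj₂ (σ j) ⌋) (allFin n)) (allFin n)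

Bn : (n : ℕ) → List (SignedMap n)
Bn n = filter (λ σ → isBij σ Data.Bool.≟ true) (allFuns (concatMap (λ b → map (λ k → (b , k)) (allFin n)) (true ∷ false ∷ [])) n)

-- inverse signed permutation: σ⁻¹(a) = sgn(σ(j)) · j where |σ(j)| = a.
-- (Search for j; the default branch never occurs for σ ∈ B_n.)
findFirst : ∀ {n} → (Fin n → Bool) → List (Fin n) → Fin n → Fin n
findFirst p [] d = d
findFirst p (j ∷ js) d = if p j then j else findFirst p js d

inverse : ∀ {n} → SignedMap n → SignedMap n
inverse {n} σ a =
  let j = findFirst (λ j → ⌊ proj₂ (σ j) ≟ᶠ a ⌋) (allFin n) a
  in proj₁ (σ j) , j

count : ∀ {A : Set} → (A → Bool) → List A → ℕ
count p xs = length (filter (λ x → p x Data.Bool.≟ true) xs)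

-- j ∈ Des(σ) (j ∈ [n-1], σ(j) > σ(j+1)), given as a predicate on j : Fin n
-- (0-based), together with d_i(σ) = |{j ∈ Des(σ) : j ≥ i}|.
isDes : ∀ {n} → SignedMap n → Fin n → Bool
isDes {n} σ j = any (λ k → ⌊ toℕ k ℕ.≟ suc (toℕ j) ⌋ ∧ ⌊ val σ k ℤ.<? val σ j ⌋) (allFin n)

d : ∀ {n} → Fin n → SignedMap n → ℕ
d {n} i σ = count (λ j → ⌊ toℕ i ℕ.≤? toℕ j ⌋ ∧ isDes σ j) (allFin n)

isNeg : ∀ {n} → SignedMap n → Fin n → Bool
isNeg σ j = proj₁ (σ j)

nNeg : ∀ {n} → Fin n → SignedMap n → ℕ
nNeg {n} i σ = count (λ j → ⌊ toℕ i ℕ.≤? toℕ j ⌋ ∧ isNeg σ j) (allFin n)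

ε : ∀ {n} → Fin n → SignedMap n → ℕ
ε i σ = if isNeg σ i then 1 else 0

module _ {c ℓ : Level} (R : CommutativeSemiring c ℓ) where
  open CommutativeSemiring R

  pow : Carrier → ℕ → Carrier
  pow x zero = 1#
  pow x (suc k) = x * pow x k

  sumL : List Carrier → Carrier
  sumL = foldr _+_ 0#

  prodF : (n : ℕ) → (Fin n → Carrier) → Carrier
  prodF n f = foldr _*_ 1# (map f (allFin n))

  genFun : (n : ℕ) → (Fin n → Carrier) → (Fin n → SignedMap n → ℕ) → Carrier
  genFun n q e = sumL (map (λ σ → prodF n (λ i → pow (q i) (e i σ))) (Bn n))

{-# OPTIONS --safe #-}
module Submission where

-- We build a bijection Φ of B_n with d_i(σ) + n_i(σ⁻¹) = 2 d_i(Φσ) + ε_i(Φσ) for every i.  Call j a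
-- switch of σ if it lies in exactly one of Des(σ) and Neg(σ⁻¹).  Position j of Φσ is negative iff an
-- odd number of switches lie at positions ≥ j, and |Φσ(j)| is the rank of σ(ρ j) among the values of
-- σ, where ρ fixes the positions that become positive and reverses the order of σ on those that become
-- negative.  So Φσ is ordered like σ on positions of equal sign: Φσ descends at j exactly when σ does,
-- unless the sign changes there, and then exactly when Φσ(j) > 0 > Φσ(j+1).  Writing D, S, E for the
-- indicators of j ∈ Des(σ), j ∈ Neg(σ⁻¹), j ∈ Des(Φσ) and m, m′ for the signs of Φσ at j, j+1, we
-- have m = D ⊕ S ⊕ m′, and the descent rule turns this into D + S + m′ = 2E + m, which telescopes
-- over the positions ≥ i to the identity above.
-- Φσ determines σ: its signs give the switches, its values give the order of σ on each sign class,
-- hence ρ and the rank of every σ(j), hence Des(σ) and then Neg(σ⁻¹); and a signed permutation is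
-- determined by Neg(σ⁻¹) together with the relative order of its entries.

open import Defs
open import Level using (Level)
open import Algebra.Bundles using (CommutativeSemiring)
open import Data.Bool as Bool using (Bool; true; false; T; if_then_else_; _∧_; _∨_; not; _xor_)
open import Data.Bool.ListAction using (all; any; or)
open import Data.Bool.Properties using (∨-identityʳ; T-∧; T-∨; T-≡; T-not-≡; xor-same; not-involutive)
open import Data.Empty using (⊥-elim)
open import Data.Fin as Fin using (Fin; toℕ)
import Data.Fin.Properties as FinP
open import Data.Integer as ℤ using (ℤ)
import Data.Integer.Properties as ℤP
open import Data.List using (List; []; _∷_; _++_; map; allFin; tabulate; length; concatMap; foldr)
open import Data.List.Properties
  using (map-tabulate; map-∘; map-cong; map-cong-local; length-tabulate; length-++; length-map)
open import Data.List.Membership.Propositional using (_∈_; find)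
open import Data.List.Membership.Propositional.Properties using (∈-allFin; ∈-filter⁻; ∈-cartesianProduct⁺)
import Data.List.Membership.Setoid as SetoidMembership
import Data.List.Membership.Setoid.Properties as SetoidMembershipP
import Data.List.Relation.Unary.All as All
import Data.List.Relation.Unary.All.Properties as AllP
import Data.List.Relation.Unary.AllPairs as AllPairs
import Data.List.Relation.Unary.AllPairs.Properties as AllPairsP
open import Data.List.Relation.Unary.Any as Any using (here; there)
import Data.List.Relation.Unary.Any.Properties as AnyP
open import Data.List.Relation.Unary.Unique.Propositional using (Unique)
import Data.List.Relation.Unary.Unique.Propositional.Properties as Unique
import Data.List.Relation.Unary.Unique.Setoid as SetoidUnique
import Data.List.Relation.Unary.Unique.Setoid.Properties as SetoidUniqueP
open import Data.Nat as ℕ using (ℕ; zero; suc; _+_; _*_; _∸_; _≤_; _<_; z≤n; s≤s)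
open import Data.Nat.Properties
open import Data.Nat.Tactic.RingSolver using (solve)
open import Data.Product using (_×_; _,_; proj₁; proj₂; ∃; map₂)
open import Data.Sum using (inj₁; inj₂; [_,_]′)
open import Data.Unit using (tt)
open import Data.Vec.Functional using () renaming (_∷_ to _∷ᶠ_)
open import Function using (_∘_; id)
open import Function.Bundles using (_⇔_; mk⇔; Equivalence)
open import Function.Definitions using (Injective)
open import Relation.Binary.Bundles using (Setoid)
open import Relation.Binary.Definitions using (tri<; tri≈; tri>)
open import Relation.Binary.PropositionalEquality
import Relation.Binary.Reasoning.Setoid as ≈-Reasoning
open import Relation.Nullary using (Dec; yes; no; ¬_)
open import Relation.Nullary.Decidable
  using (⌊_⌋; does-⇔; isYes≗does; toWitness; fromWitness; toWitnessFalse; fromWitnessFalse)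

⌊⌋-⇔ : ∀ {A B : Set} → A ⇔ B → (a? : Dec A) (b? : Dec B) → ⌊ a? ⌋ ≡ ⌊ b? ⌋
⌊⌋-⇔ A⇔B a? b? = trans (isYes≗does a?) (trans (does-⇔ A⇔B a? b?) (sym (isYes≗does b?)))

T-true : ∀ {b} → b ≡ true → T b
T-true = Equivalence.from T-≡

T-not-false : ∀ {b} → b ≡ false → T (not b)
T-not-false = Equivalence.from T-not-≡

bool-cases : ∀ {ℓ} {P : Set ℓ} b → (b ≡ true → P) → (b ≡ false → P) → P
bool-cases true  t f = t refl
bool-cases false t f = f refl

-- Defined by if_then_else_ so that ε i σ is bit (isNeg σ i) by definition.
bit : Bool → ℕ
bit b = if b then 1 else 0

bit-mono : ∀ {a b} → (T a → T b) → bit a ≤ bit b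
bit-mono {false}         a⇒b = z≤n
bit-mono {true}  {true}  a⇒b = ≤-refl
bit-mono {true}  {false} a⇒b = ⊥-elim (a⇒b tt)

parity : ℕ → Bool
parity zero    = false
parity (suc k) = not (parity k)

parity-bit+ : ∀ b k → parity (bit b + k) ≡ b xor parity k
parity-bit+ true  k = refl
parity-bit+ false k = refl

xor-cancelʳ : ∀ a b → (a xor b) xor b ≡ a
xor-cancelʳ true  true  = refl
xor-cancelʳ true  false = refl
xor-cancelʳ false true  = refl
xor-cancelʳ false false = refl

xor-cancelˡ : ∀ a b → a xor (a xor b) ≡ b
xor-cancelˡ true  b = not-involutive b
xor-cancelˡ false b = refl

∸-suc-< : ∀ {K r} → r < K → K ∸ suc r < K
∸-suc-< r<K = ∸-monoʳ-< ℕ.z<s r<K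

∸-suc-involutive : ∀ {K r} → r < K → K ∸ suc (K ∸ suc r) ≡ r
∸-suc-involutive {suc K} (s≤s r≤K) = m∸[m∸n]≡n r≤K

∸-suc-reverses-< : ∀ {K a b} → a < K → b < K → ⌊ K ∸ suc a ℕ.<? K ∸ suc b ⌋ ≡ ⌊ b ℕ.<? a ⌋
∸-suc-reverses-< {suc K} {a} {b} (s≤s a≤K) (s≤s b≤K) =
  ⌊⌋-⇔ (mk⇔ (∸-cancelʳ-< {a} {b} {K}) (λ b<a → ∸-monoʳ-< b<a a≤K)) _ _

module _ {A : Set} where

  count-∷ : ∀ (p : A → Bool) x xs → count p (x ∷ xs) ≡ bit (p x) + count p xs
  count-∷ p x xs with p x
  ... | true  = refl
  ... | false = refl

  count-cong : ∀ {p q : A → Bool} xs → (∀ x → p x ≡ q x) → count p xs ≡ count q xs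
  count-cong [] p≗q = refl
  count-cong {p} {q} (x ∷ xs) p≗q = begin
    count p (x ∷ xs)          ≡⟨ count-∷ p x xs ⟩
    bit (p x) + count p xs    ≡⟨ cong₂ _+_ (cong bit (p≗q x)) (count-cong xs p≗q) ⟩
    bit (q x) + count q xs    ≡⟨ count-∷ q x xs ⟨
    count q (x ∷ xs)          ∎
    where open ≡-Reasoning

  count-mono : ∀ {p q : A → Bool} xs → (∀ x → T (p x) → T (q x)) → count p xs ≤ count q xs
  count-mono [] p⇒q = z≤n
  count-mono {p} {q} (x ∷ xs) p⇒q rewrite count-∷ p x xs | count-∷ q x xs =
    +-mono-≤ (bit-mono (p⇒q x)) (count-mono xs p⇒q)

  count-< : ∀ {p q : A → Bool} xs → (∀ x → T (p x) → T (q x)) →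
            ∀ {y} → y ∈ xs → ¬ T (p y) → T (q y) → count p xs < count q xs
  count-< {p} {q} (x ∷ xs) p⇒q (here refl) ¬py qy rewrite count-∷ p x xs | count-∷ q x xs
    with p x | q x
  ... | false | true  = s≤s (count-mono xs p⇒q)
  ... | true  | _     = ⊥-elim (¬py tt)
  count-< {p} {q} (x ∷ xs) p⇒q (there y∈xs) ¬py qy rewrite count-∷ p x xs | count-∷ q x xs =
    +-mono-≤-< (bit-mono (p⇒q x)) (count-< xs p⇒q y∈xs ¬py qy)

  count-≤-length : ∀ (p : A → Bool) xs → count p xs ≤ length xs
  count-≤-length p [] = z≤n
  count-≤-length p (x ∷ xs) with p x
  ... | false = m≤n⇒m≤1+n (count-≤-length p xs)
  ... | true  = s≤s (count-≤-length p xs)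

  count-<-length : ∀ (p : A → Bool) {xs y} → y ∈ xs → ¬ T (p y) → count p xs < length xs
  count-<-length p {x ∷ xs} (here refl) ¬py with p x
  ... | false = s≤s (count-≤-length p xs)
  ... | true  = ⊥-elim (¬py tt)
  count-<-length p {x ∷ xs} (there y∈xs) ¬py with p x
  ... | false = m≤n⇒m≤1+n (count-<-length p y∈xs ¬py)
  ... | true  = s≤s (count-<-length p y∈xs ¬py)

  count-complement : ∀ (p : A → Bool) xs → count p xs + count (not ∘ p) xs ≡ length xs
  count-complement p [] = refl
  count-complement p (x ∷ xs) with p x
  ... | true  = cong suc (count-complement p xs)
  ... | false = trans (+-suc _ _) (cong suc (count-complement p xs))

count-map : ∀ {A B : Set} (p : B → Bool) (f : A → B) xs → count p (map f xs) ≡ count (p ∘ f) xs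
count-map p f [] = refl
count-map p f (x ∷ xs) rewrite count-∷ p (f x) (map f xs) | count-∷ (p ∘ f) x xs =
  cong (bit (p (f x)) +_) (count-map p f xs)

any-cong : ∀ {A : Set} {p q : A → Bool} xs → (∀ x → p x ≡ q x) → any p xs ≡ any q xs
any-cong [] p≗q = refl
any-cong (x ∷ xs) p≗q = cong₂ _∨_ (p≗q x) (any-cong xs p≗q)

any-false : ∀ {A : Set} (xs : List A) → any (λ _ → false) xs ≡ false
any-false [] = refl
any-false (x ∷ xs) = any-false xs

count-allFin-suc : ∀ {n} (p : Fin (suc n) → Bool) →
                   count p (allFin (suc n)) ≡ bit (p Fin.zero) + count (p ∘ Fin.suc) (allFin n)
count-allFin-suc {n} p = begin
  count p (allFin (suc n))
    ≡⟨ count-∷ p Fin.zero (tabulate Fin.suc) ⟩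
  bit (p Fin.zero) + count p (tabulate Fin.suc)
    ≡⟨ cong (λ xs → bit (p Fin.zero) + count p xs) (map-tabulate id Fin.suc) ⟨
  bit (p Fin.zero) + count p (map Fin.suc (allFin n))
    ≡⟨ cong (bit (p Fin.zero) +_) (count-map p Fin.suc (allFin n)) ⟩
  bit (p Fin.zero) + count (p ∘ Fin.suc) (allFin n)
    ∎
  where open ≡-Reasoning

any-allFin-suc : ∀ {n} (p : Fin (suc n) → Bool) →
                 any p (allFin (suc n)) ≡ p Fin.zero ∨ any (p ∘ Fin.suc) (allFin n)
any-allFin-suc {n} p = cong (λ bs → p Fin.zero ∨ or bs)
  (trans (cong (map p) (sym (map-tabulate id Fin.suc))) (sym (map-∘ (allFin n))))

module _ {c ℓ} (S : Setoid c ℓ) where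

  open Setoid S renaming (refl to ≈-refl; sym to ≈-sym; trans to ≈-trans)
  open import Data.List.Relation.Binary.Permutation.Setoid S
  open import Data.List.Relation.Binary.Permutation.Setoid.Properties S using (shift)
  open import Data.List.Relation.Binary.Equality.Setoid S using (≋-sym; ≋-length)
  open import Data.List.Relation.Binary.Subset.Setoid S using (_⊆_)
  open SetoidMembershipP using (∈-∃++; ∈-resp-≈; ∈-resp-≋; All[≉]⇒∉; ∈-++⁻; ∈-++⁺ˡ; ∈-++⁺ʳ)

  unique-⊆-length⇒↭ : ∀ {xs ys} → SetoidUnique.Unique S xs → xs ⊆ ys → length xs ≡ length ys →
                      xs ↭ ys
  unique-⊆-length⇒↭ {[]} {[]} _ _ _ = ↭-refl
  unique-⊆-length⇒↭ {x ∷ xs} {ys} (x∉xs AllPairs.∷ xs!) xs⊆ys |xs|≡|ys|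
    with ∈-∃++ S (xs⊆ys (here ≈-refl))
  ... | as , bs , w , x≈w , ys≋ = ↭-trans (prep ≈-refl xs↭as++bs)
        (↭-trans (↭-sym (shift (≈-sym x≈w) as bs)) (↭-reflexive-≋ (≋-sym ys≋)))
    where
    xs⊆as++bs : xs ⊆ as ++ bs
    xs⊆as++bs {z} z∈xs with ∈-++⁻ S as (∈-resp-≋ S ys≋ (xs⊆ys (there z∈xs)))
    ... | inj₁ z∈as         = ∈-++⁺ˡ S z∈as
    ... | inj₂ (here z≈w)   = ⊥-elim (All[≉]⇒∉ S x∉xs (∈-resp-≈ S (≈-trans z≈w (≈-sym x≈w)) z∈xs))
    ... | inj₂ (there z∈bs) = ∈-++⁺ʳ S as z∈bs
    xs↭as++bs : xs ↭ as ++ bs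
    xs↭as++bs = unique-⊆-length⇒↭ xs! xs⊆as++bs (suc-injective (begin
      suc (length xs)            ≡⟨ |xs|≡|ys| ⟩
      length ys                  ≡⟨ ≋-length ys≋ ⟩
      length (as ++ w ∷ bs)      ≡⟨ length-++ as ⟩
      length as + suc (length bs) ≡⟨ +-suc (length as) (length bs) ⟩
      suc (length as + length bs) ≡⟨ cong suc (length-++ as) ⟨
      suc (length (as ++ bs))    ∎))
      where open ≡-Reasoning

module _ {a b ℓ₁ ℓ₂} (S : Setoid a ℓ₁) (R : Setoid b ℓ₂) where

  private
    module S = Setoid S
    module R = Setoid R

  unique-map⁺-on : ∀ {p} {P : S.Carrier → Set p} {f : S.Carrier → R.Carrier} {xs} → All.All P xs →
                   (∀ {x y} → P x → P y → f x R.≈ f y → x S.≈ y) →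
                   SetoidUnique.Unique S xs → SetoidUnique.Unique R (map f xs)
  unique-map⁺-on All.[] f-inj AllPairs.[] = AllPairs.[]
  unique-map⁺-on (px All.∷ pxs) f-inj (x≉xs AllPairs.∷ xs!) =
    AllP.map⁺ (All.zipWith (λ (x≉y , py) fx≈fy → x≉y (f-inj px py fx≈fy)) (x≉xs , pxs))
    AllPairs.∷ unique-map⁺-on pxs f-inj xs!

module _ {A : Set} where

  open import Data.List.Relation.Binary.Permutation.Setoid (setoid A) using (_↭_)
  open import Data.List.Relation.Binary.Permutation.Setoid.Properties (setoid A)
    using (filter⁺; xs↭ys⇒|xs|≡|ys|)

  count-↭ : ∀ (p : A → Bool) {xs ys} → xs ↭ ys → count p xs ≡ count p ys
  count-↭ p xs↭ys =
    xs↭ys⇒|xs|≡|ys| (filter⁺ (λ x → p x Bool.≟ true) (subst (λ x → p x ≡ true)) xs↭ys)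

count-permute : ∀ {n} (p : Fin n → Bool) {f : Fin n → Fin n} → Injective _≡_ _≡_ f →
                count (p ∘ f) (allFin n) ≡ count p (allFin n)
count-permute {n} p {f} f-injective = trans (sym (count-map p f (allFin n)))
  (count-↭ p (unique-⊆-length⇒↭ (setoid (Fin n)) (Unique.map⁺ f-injective (Unique.allFin⁺ n))
    (λ _ → ∈-allFin _) (length-map f (allFin n))))

findFirst-spec : ∀ {n} (p : Fin n → Bool) xs d {x} → x ∈ xs → T (p x) → T (p (findFirst p xs d))
findFirst-spec p (y ∷ xs) d x∈ px with p y in py
... | true = T-true py
... | false with x∈
...   | here refl   = ⊥-elim (subst T py px)
...   | there x∈xs  = findFirst-spec p xs d x∈xs px

injective⇒onto : ∀ {n} (f : Fin n → ℕ) → (∀ j → f j < n) → (∀ {a b} → f a ≡ f b → a ≡ b) →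
                 ∀ r → r < n → ∃ λ j → f j ≡ r
injective⇒onto {suc m} f f<n f-injective r r<n with FinP.any? (λ j → f j ℕ.≟ r)
... | yes hit  = hit
... | no  miss = ⊥-elim (<-irrefl refl (FinP.injective⇒≤ punched-injective))
  where
  r≢f : ∀ j → Fin.fromℕ< r<n ≢ Fin.fromℕ< (f<n j)
  r≢f j eq = miss (j , (begin
    f j                        ≡⟨ FinP.toℕ-fromℕ< (f<n j) ⟨
    toℕ (Fin.fromℕ< (f<n j))   ≡⟨ cong toℕ eq ⟨
    toℕ (Fin.fromℕ< r<n)       ≡⟨ FinP.toℕ-fromℕ< r<n ⟩
    r                          ∎))
    where open ≡-Reasoning
  punched : Fin (suc m) → Fin m
  punched j = Fin.punchOut (r≢f j)
  punched-injective : ∀ {a b} → punched a ≡ punched b → a ≡ b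
  punched-injective {a} {b} eq = f-injective (begin
    f a                        ≡⟨ FinP.toℕ-fromℕ< (f<n a) ⟨
    toℕ (Fin.fromℕ< (f<n a))   ≡⟨ cong toℕ (FinP.punchOut-injective (r≢f a) (r≢f b) eq) ⟩
    toℕ (Fin.fromℕ< (f<n b))   ≡⟨ FinP.toℕ-fromℕ< (f<n b) ⟩
    f b                        ∎)
    where open ≡-Reasoning

suffixCount : ∀ {n} → (Fin n → Bool) → ℕ → ℕ
suffixCount {n} P k = count (λ j → ⌊ k ℕ.≤? toℕ j ⌋ ∧ P j) (allFin n)

module _ {n} (P : Fin (suc n) → Bool) where

  suffixCount-zero : suffixCount P 0 ≡ bit (P Fin.zero) + suffixCount (P ∘ Fin.suc) 0
  suffixCount-zero = count-allFin-suc (λ j → ⌊ 0 ℕ.≤? toℕ j ⌋ ∧ P j)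

  suffixCount-suc : ∀ k → suffixCount P (suc k) ≡ suffixCount (P ∘ Fin.suc) k
  suffixCount-suc k = trans (count-allFin-suc (λ j → ⌊ suc k ℕ.≤? toℕ j ⌋ ∧ P j))
    (count-cong (allFin n) λ j → cong (_∧ P (Fin.suc j))
      (⌊⌋-⇔ (mk⇔ ℕ.s≤s⁻¹ s≤s) (suc k ℕ.≤? suc (toℕ j)) (k ℕ.≤? toℕ j)))

suffixCount-toℕ : ∀ {n} (P : Fin n → Bool) j →
                  suffixCount P (toℕ j) ≡ bit (P j) + suffixCount P (suc (toℕ j))
suffixCount-toℕ P Fin.zero =
  trans (suffixCount-zero P) (cong (bit (P Fin.zero) +_) (sym (suffixCount-suc P 0)))
suffixCount-toℕ P (Fin.suc j) = begin
  suffixCount P (suc (toℕ j))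
    ≡⟨ suffixCount-suc P (toℕ j) ⟩
  suffixCount (P ∘ Fin.suc) (toℕ j)
    ≡⟨ suffixCount-toℕ (P ∘ Fin.suc) j ⟩
  bit (P (Fin.suc j)) + suffixCount (P ∘ Fin.suc) (suc (toℕ j))
    ≡⟨ cong (bit (P (Fin.suc j)) +_) (suffixCount-suc P (suc (toℕ j))) ⟨
  bit (P (Fin.suc j)) + suffixCount P (suc (suc (toℕ j)))
    ∎
  where open ≡-Reasoning

suffixCount-beyond : ∀ {n} (P : Fin n → Bool) k → n ≤ k → suffixCount P k ≡ 0
suffixCount-beyond {zero}  P k       _         = refl
suffixCount-beyond {suc n} P (suc k) (s≤s n≤k) =
  trans (suffixCount-suc P k) (suffixCount-beyond (P ∘ Fin.suc) k n≤k)

-- By definition isDes σ j is (λ k → ⌊ val σ k ℤ.<? val σ j ⌋) ⟨ suc (toℕ j) ⟩, and d i σ,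
-- nNeg i σ are suffixCounts at toℕ i.
_⟨_⟩ : ∀ {n} → (Fin n → Bool) → ℕ → Bool
_⟨_⟩ {n} P t = any (λ j → ⌊ toℕ j ℕ.≟ t ⌋ ∧ P j) (allFin n)

⟨⟩-suc : ∀ {n} (P : Fin (suc n) → Bool) t → P ⟨ suc t ⟩ ≡ (P ∘ Fin.suc) ⟨ t ⟩
⟨⟩-suc {n} P t = trans (any-allFin-suc (λ j → ⌊ toℕ j ℕ.≟ suc t ⌋ ∧ P j))
  (any-cong (allFin n) λ j → cong (_∧ P (Fin.suc j))
    (⌊⌋-⇔ (mk⇔ suc-injective (cong suc)) (suc (toℕ j) ℕ.≟ suc t) (toℕ j ℕ.≟ t)))

⟨⟩-cong : ∀ {n} {P Q : Fin n → Bool} → (∀ x → P x ≡ Q x) → ∀ t → P ⟨ t ⟩ ≡ Q ⟨ t ⟩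
⟨⟩-cong {n} P≗Q t = any-cong (allFin n) (λ x → cong (⌊ toℕ x ℕ.≟ t ⌋ ∧_) (P≗Q x))

⟨⟩-toℕ : ∀ {n} (P : Fin n → Bool) j → P ⟨ toℕ j ⟩ ≡ P j
⟨⟩-toℕ {suc n} P Fin.zero = begin
  P ⟨ 0 ⟩                                  ≡⟨ any-allFin-suc (λ j → ⌊ toℕ j ℕ.≟ 0 ⌋ ∧ P j) ⟩
  P Fin.zero ∨ any (λ _ → false) (allFin n) ≡⟨ cong (P Fin.zero ∨_) (any-false (allFin n)) ⟩
  P Fin.zero ∨ false                       ≡⟨ ∨-identityʳ (P Fin.zero) ⟩
  P Fin.zero                               ∎
  where open ≡-Reasoning
⟨⟩-toℕ {suc n} P (Fin.suc j) = trans (⟨⟩-suc P (toℕ j)) (⟨⟩-toℕ (P ∘ Fin.suc) j)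

⟨⟩-beyond : ∀ {n} (P : Fin n → Bool) t → n ≤ t → P ⟨ t ⟩ ≡ false
⟨⟩-beyond {zero}  P t       _         = refl
⟨⟩-beyond {suc n} P (suc t) (s≤s n≤t) = trans (⟨⟩-suc P t) (⟨⟩-beyond (P ∘ Fin.suc) t n≤t)

suffixCount-telescope :
  ∀ {n} (D S E : Fin n → Bool) (m : ℕ → Bool) → (∀ k → n ≤ k → m k ≡ false) →
  (∀ j → bit (D j) + bit (S j) + bit (m (suc (toℕ j))) ≡ 2 * bit (E j) + bit (m (toℕ j))) →
  ∀ k → suffixCount D k + suffixCount S k ≡ 2 * suffixCount E k + bit (m k)
suffixCount-telescope {zero} D S E m m-beyond local k rewrite m-beyond k z≤n = refl
suffixCount-telescope {suc n} D S E m m-beyond local k = go k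
  where
  shifted : ∀ k → suffixCount (D ∘ Fin.suc) k + suffixCount (S ∘ Fin.suc) k
                ≡ 2 * suffixCount (E ∘ Fin.suc) k + bit (m (suc k))
  shifted = suffixCount-telescope (D ∘ Fin.suc) (S ∘ Fin.suc) (E ∘ Fin.suc) (m ∘ suc)
              (λ k n≤k → m-beyond (suc k) (s≤s n≤k)) (local ∘ Fin.suc)

  add : ∀ x y z w v a b c → x + y + z ≡ 2 * w + v → a + b ≡ 2 * c + z →
        (x + a) + (y + b) ≡ 2 * (w + c) + v
  add x y z w v a b c xyz ab = +-cancelʳ-≡ z _ _ (begin
    (x + a) + (y + b) + z     ≡⟨ solve (x ∷ y ∷ z ∷ a ∷ b ∷ []) ⟩
    (x + y + z) + (a + b)     ≡⟨ cong₂ _+_ xyz ab ⟩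
    (2 * w + v) + (2 * c + z) ≡⟨ solve (w ∷ v ∷ c ∷ z ∷ []) ⟩
    2 * (w + c) + v + z       ∎)
    where open ≡-Reasoning

  go : ∀ k → suffixCount D k + suffixCount S k ≡ 2 * suffixCount E k + bit (m k)
  go zero
    rewrite suffixCount-zero D | suffixCount-zero S | suffixCount-zero E =
    add (bit (D Fin.zero)) (bit (S Fin.zero)) (bit (m 1)) (bit (E Fin.zero)) (bit (m 0))
        (suffixCount (D ∘ Fin.suc) 0) (suffixCount (S ∘ Fin.suc) 0) (suffixCount (E ∘ Fin.suc) 0)
        (local Fin.zero) (shifted 0)
  go (suc k)
    rewrite suffixCount-suc D k | suffixCount-suc S k | suffixCount-suc E k = shifted k

module Rank {n} (v : Fin n → ℤ) where

  less : Fin n → Fin n → Bool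
  less x y = ⌊ v x ℤ.<? v y ⌋

  rank : (Fin n → Bool) → Fin n → ℕ
  rank F j = count (λ x → F x ∧ less x j) (allFin n)

  private
    unpack : ∀ (F : Fin n → Bool) x j → T (F x ∧ less x j) → T (F x) × v x ℤ.< v j
    unpack F x j h = let Fx , x<j = Equivalence.to (T-∧ {F x} {less x j}) h in Fx , toWitness x<j

    pack : ∀ (F : Fin n → Bool) x j → T (F x) → v x ℤ.< v j → T (F x ∧ less x j)
    pack F x j Fx x<j = Equivalence.from (T-∧ {F x} {less x j}) (Fx , fromWitness x<j)

    ¬less-refl : ∀ (F : Fin n → Bool) x → ¬ T (F x ∧ less x x)
    ¬less-refl F x h = ℤP.<-irrefl refl (proj₂ (unpack F x x h))

  rank<n : ∀ (F : Fin n → Bool) j → rank F j < n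
  rank<n F j = subst (rank F j <_) (length-tabulate id)
    (count-<-length (λ x → F x ∧ less x j) (∈-allFin j) (¬less-refl F j))

  rank<count : ∀ (F : Fin n → Bool) {j} → T (F j) → rank F j < count F (allFin n)
  rank<count F {j} Fj = count-< (allFin n) (λ x → proj₁ ∘ unpack F x j) (∈-allFin j) (¬less-refl F j) Fj

  rank-< : ∀ (F : Fin n → Bool) {a b} → T (F a) → v a ℤ.< v b → rank F a < rank F b
  rank-< F {a} {b} Fa a<b = count-< (allFin n) x<a⇒x<b (∈-allFin a) (¬less-refl F a) (pack F a b Fa a<b)
    where
    x<a⇒x<b : ∀ x → T (F x ∧ less x a) → T (F x ∧ less x b)
    x<a⇒x<b x h = let Fx , x<a = unpack F x a h in pack F x b Fx (ℤP.<-trans x<a a<b)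

  rank-≡ : ∀ (F : Fin n → Bool) {a b} → v a ≡ v b → rank F a ≡ rank F b
  rank-≡ F va≡vb = count-cong (allFin n) λ x → cong (λ z → F x ∧ ⌊ v x ℤ.<? z ⌋) va≡vb

  rank<⇒< : ∀ (F : Fin n → Bool) {a b} → T (F b) → rank F a < rank F b → v a ℤ.< v b
  rank<⇒< F {a} {b} Fb r< with ℤP.<-cmp (v a) (v b)
  ... | tri< a<b _ _ = a<b
  ... | tri≈ _ a≈b _ = ⊥-elim (<-irrefl (rank-≡ F a≈b) r<)
  ... | tri> _ _ b<a = ⊥-elim (<-asym r< (rank-< F Fb b<a))

  less≡rank< : ∀ (F : Fin n → Bool) {a b} → T (F a) → T (F b) →
               less a b ≡ ⌊ rank F a ℕ.<? rank F b ⌋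
  less≡rank< F Fa Fb = ⌊⌋-⇔ (mk⇔ (rank-< F Fa) (rank<⇒< F Fb)) _ _

  module _ (v-injective : ∀ {a b} → v a ≡ v b → a ≡ b) where

    rank-injective : ∀ (F : Fin n → Bool) {a b} → T (F a) → T (F b) → rank F a ≡ rank F b → a ≡ b
    rank-injective F {a} {b} Fa Fb r≡ with ℤP.<-cmp (v a) (v b)
    ... | tri< a<b _ _ = ⊥-elim (<-irrefl r≡ (rank-< F Fa a<b))
    ... | tri≈ _ a≈b _ = v-injective a≈b
    ... | tri> _ _ b<a = ⊥-elim (<-irrefl (sym r≡) (rank-< F Fb b<a))

    rank-onto : ∀ (F : Fin n → Bool) r → r < count F (allFin n) → ∃ λ x → T (F x) × rank F x ≡ r
    rank-onto F r r<K = hit (injective⇒onto place place<n place-injective r (<-≤-trans r<K K≤n))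
      where
      K = count F (allFin n)

      K+K̄≡n : K + count (not ∘ F) (allFin n) ≡ n
      K+K̄≡n = trans (count-complement F (allFin n)) (length-tabulate id)

      K≤n : K ≤ n
      K≤n = subst (K ≤_) K+K̄≡n (m≤m+n K _)

      -- The F-positions in order, then the others: an injection into [0, n), hence onto.
      place : Fin n → ℕ
      place x = if F x then rank F x else K + rank (not ∘ F) x

      place<n : ∀ x → place x < n
      place<n x with F x in Fx
      ... | true  = <-≤-trans (rank<count F (T-true Fx)) K≤n
      ... | false = subst (K + rank (not ∘ F) x <_) K+K̄≡n
                      (+-monoʳ-< K (rank<count (not ∘ F) (T-not-false Fx)))

      place-injective : ∀ {a b} → place a ≡ place b → a ≡ b
      place-injective {a} {b} eq with F a in Fa | F b in Fb
      ... | true  | true  = rank-injective F (T-true Fa) (T-true Fb) eq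
      ... | false | false = rank-injective (not ∘ F) (T-not-false Fa) (T-not-false Fb) (+-cancelˡ-≡ K _ _ eq)
      ... | true  | false = ⊥-elim (m+n≮m K _ (subst (_< K) eq (rank<count F (T-true Fa))))
      ... | false | true  = ⊥-elim (m+n≮m K _ (subst (_< K) (sym eq) (rank<count F (T-true Fb))))

      hit : (∃ λ x → place x ≡ r) → ∃ λ x → T (F x) × rank F x ≡ r
      hit (x , eq) with F x in Fx
      ... | true  = x , T-true Fx , eq
      ... | false = ⊥-elim (m+n≮m K _ (subst (_< K) (sym eq) r<K))

rank-reindex : ∀ {n} {v w : Fin n → ℤ} {f : Fin n → Fin n} → Injective _≡_ _≡_ f →
               (∀ x → v x ≡ w (f x)) → ∀ F j → Rank.rank v (F ∘ f) j ≡ Rank.rank w F (f j)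
rank-reindex {n} {v} {w} {f} f-injective v≗w∘f F j = begin
  count (λ x → F (f x) ∧ ⌊ v x ℤ.<? v j ⌋) (allFin n)
    ≡⟨ count-cong (allFin n) (λ x → cong₂ (λ a b → F (f x) ∧ ⌊ a ℤ.<? b ⌋) (v≗w∘f x) (v≗w∘f j)) ⟩
  count (λ x → F (f x) ∧ ⌊ w (f x) ℤ.<? w (f j) ⌋) (allFin n)
    ≡⟨ count-permute (λ a → F a ∧ ⌊ w a ℤ.<? w (f j) ⌋) f-injective ⟩
  count (λ a → F a ∧ ⌊ w a ℤ.<? w (f j) ⌋) (allFin n)
    ∎
  where open ≡-Reasoning

IsSignedPermutation : ∀ {n} → SignedMap n → Set
IsSignedPermutation σ = Injective _≡_ _≡_ (proj₂ ∘ σ)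

SignedMaps : ℕ → Setoid _ _
SignedMaps n = Fin n →-setoid (Bool × Fin n)

signed : ∀ {n} → Bool × Fin n → ℤ
signed (false , k) = ℤ.+ suc (toℕ k)
signed (true  , k) = ℤ.-[1+ toℕ k ]

val≡signed : ∀ {n} (σ : SignedMap n) i → val σ i ≡ signed (σ i)
val≡signed σ i with σ i
... | false , k = refl
... | true  , k = refl

signed-injective : ∀ {n} {x y : Bool × Fin n} → signed x ≡ signed y → x ≡ y
signed-injective {x = false , a} {false , b} eq =
  cong (false ,_) (FinP.toℕ-injective (suc-injective (ℤP.+-injective eq)))
signed-injective {x = true  , a} {true  , b} eq =
  cong (true ,_) (FinP.toℕ-injective (ℤP.-[1+-injective eq))

val-resp-≗ : ∀ {n} {σ τ : SignedMap n} → σ ≗ τ → ∀ i → val σ i ≡ val τ i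
val-resp-≗ {σ = σ} {τ} σ≗τ i =
  trans (val≡signed σ i) (trans (cong signed (σ≗τ i)) (sym (val≡signed τ i)))

signedPermutation-resp-≗ : ∀ {n} {σ τ : SignedMap n} → σ ≗ τ →
                           IsSignedPermutation σ → IsSignedPermutation τ
signedPermutation-resp-≗ σ≗τ σ-perm {i} {j} eq =
  σ-perm (trans (cong proj₂ (σ≗τ i)) (trans eq (sym (cong proj₂ (σ≗τ j)))))

inverse-sign : ∀ {n} (σ : SignedMap n) → IsSignedPermutation σ →
               ∀ j → isNeg (inverse σ) (proj₂ (σ j)) ≡ proj₁ (σ j)
inverse-sign {n} σ σ-perm j = cong (proj₁ ∘ σ) (σ-perm (toWitness found))
  where
  hits : Fin n → Bool
  hits i = ⌊ proj₂ (σ i) FinP.≟ proj₂ (σ j) ⌋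
  found : T (hits (findFirst hits (allFin n) (proj₂ (σ j))))
  found = findFirst-spec hits (allFin n) (proj₂ (σ j)) (∈-allFin j) (fromWitness refl)

signedLess : Bool → Bool → Bool → Bool
signedLess sx sy b = if sx xor sy then sx else b

signedLess-same : ∀ s b → signedLess s s b ≡ b
signedLess-same s b rewrite xor-same s = refl

signedLess-false : ∀ s → signedLess false s false ≡ false
signedLess-false true  = refl
signedLess-false false = refl

signedLess-balance : ∀ D S m′ →
  bit D + bit S + bit m′ ≡ 2 * bit (signedLess m′ ((D xor S) xor m′) D) + bit ((D xor S) xor m′)
signedLess-balance true  true  true  = refl
signedLess-balance true  true  false = refl
signedLess-balance true  false true  = refl
signedLess-balance true  false false = refl
signedLess-balance false true  true  = refl
signedLess-balance false true  false = refl
signedLess-balance false false true  = refl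
signedLess-balance false false false = refl

signed-<-positive : ∀ {n} (a b : Fin n) →
                    ⌊ signed (false , a) ℤ.<? signed (false , b) ⌋ ≡ ⌊ toℕ a ℕ.<? toℕ b ⌋
signed-<-positive a b = ⌊⌋-⇔ (mk⇔ (ℕ.s≤s⁻¹ ∘ ℤP.drop‿+<+) (ℤ.+<+ ∘ s≤s)) _ _

signed-<-negative : ∀ {n} (a b : Fin n) →
                    ⌊ signed (true , a) ℤ.<? signed (true , b) ⌋ ≡ ⌊ toℕ b ℕ.<? toℕ a ⌋
signed-<-negative a b = ⌊⌋-⇔ (mk⇔ ℤP.drop‿-<- ℤ.-<-) _ _

signed-<-mixed : ∀ {n} s (a b : Fin n) → ⌊ signed (s , a) ℤ.<? signed (not s , b) ⌋ ≡ s
signed-<-mixed true  a b =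
  Equivalence.to T-≡ (fromWitness {a? = signed (true , a) ℤ.<? signed (false , b)} ℤ.-<+)
signed-<-mixed false a b =
  Equivalence.to T-not-≡ (fromWitnessFalse {a? = signed (false , a) ℤ.<? signed (true , b)} λ ())

module Construction {n} (σ : SignedMap n) where

  open Rank (val σ) public

  switch : Fin n → Bool
  switch j = isDes σ j xor isNeg (inverse σ) j

  negative : ℕ → Bool
  negative k = parity (suffixCount switch k)

  sign : Fin n → Bool
  sign j = negative (toℕ j)

  K : ℕ
  K = count sign (allFin n)

  isMirrorOf : Fin n → Fin n → Bool
  isMirrorOf j x = sign x ∧ ⌊ rank sign x ℕ.≟ K ∸ suc (rank sign j) ⌋

  -- Only meaningful when sign j holds, which is the only case in which ρ uses it.
  mirror : Fin n → Fin n
  mirror j = findFirst (isMirrorOf j) (allFin n) j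

  ρ : Fin n → Fin n
  ρ j = if sign j then mirror j else j

  π : Fin n → Fin n
  π j = Fin.fromℕ< (rank<n (λ _ → true) j)

  Φ : SignedMap n
  Φ j = sign j , π (ρ j)

module ConstructionProperties {n} (σ : SignedMap n) (σ-perm : IsSignedPermutation σ) where

  open Construction σ

  val-injective : ∀ {a b} → val σ a ≡ val σ b → a ≡ b
  val-injective {a} {b} eq = σ-perm (cong proj₂ (signed-injective (begin
    signed (σ a) ≡⟨ val≡signed σ a ⟨
    val σ a      ≡⟨ eq ⟩
    val σ b      ≡⟨ val≡signed σ b ⟩
    signed (σ b) ∎)))
    where open ≡-Reasoning

  mirror-spec : ∀ {j} → T (sign j) → T (sign (mirror j)) × rank sign (mirror j) ≡ K ∸ suc (rank sign j)
  mirror-spec {j} sj = map₂ toWitness (Equivalence.to (T-∧ {sign (mirror j)}) found)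
    where
    target : ∃ λ x → T (sign x) × rank sign x ≡ K ∸ suc (rank sign j)
    target = rank-onto val-injective sign (K ∸ suc (rank sign j)) (∸-suc-< (rank<count sign sj))

    target-matches : T (isMirrorOf j (proj₁ target))
    target-matches = let _ , sx , rx = target in
      Equivalence.from (T-∧ {sign (proj₁ target)}) (sx , fromWitness rx)

    found : T (isMirrorOf j (mirror j))
    found = findFirst-spec (isMirrorOf j) (allFin n) j (∈-allFin (proj₁ target)) target-matches

  mirror-sign : ∀ {j} → T (sign j) → T (sign (mirror j))
  mirror-sign = proj₁ ∘ mirror-spec

  rank-mirror : ∀ {j} → T (sign j) → rank sign (mirror j) ≡ K ∸ suc (rank sign j)
  rank-mirror = proj₂ ∘ mirror-spec

  mirror-involutive : ∀ {j} → T (sign j) → mirror (mirror j) ≡ j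
  mirror-involutive {j} sj = rank-injective val-injective sign (mirror-sign (mirror-sign sj)) sj (begin
    rank sign (mirror (mirror j))    ≡⟨ rank-mirror (mirror-sign sj) ⟩
    K ∸ suc (rank sign (mirror j))   ≡⟨ cong (λ r → K ∸ suc r) (rank-mirror sj) ⟩
    K ∸ suc (K ∸ suc (rank sign j))  ≡⟨ ∸-suc-involutive (rank<count sign sj) ⟩
    rank sign j                      ∎)
    where open ≡-Reasoning

  mirror-reverses : ∀ {a b} → T (sign a) → T (sign b) → less (mirror a) (mirror b) ≡ less b a
  mirror-reverses {a} {b} sa sb = begin
    less (mirror a) (mirror b)
      ≡⟨ less≡rank< sign (mirror-sign sa) (mirror-sign sb) ⟩
    ⌊ rank sign (mirror a) ℕ.<? rank sign (mirror b) ⌋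
      ≡⟨ cong₂ (λ r s → ⌊ r ℕ.<? s ⌋) (rank-mirror sa) (rank-mirror sb) ⟩
    ⌊ K ∸ suc (rank sign a) ℕ.<? K ∸ suc (rank sign b) ⌋
      ≡⟨ ∸-suc-reverses-< (rank<count sign sa) (rank<count sign sb) ⟩
    ⌊ rank sign b ℕ.<? rank sign a ⌋
      ≡⟨ less≡rank< sign sb sa ⟨
    less b a
      ∎
    where open ≡-Reasoning

  ρ-negative : ∀ {j} → sign j ≡ true → ρ j ≡ mirror j
  ρ-negative {j} sj = cong (if_then mirror j else j) sj

  ρ-positive : ∀ {j} → sign j ≡ false → ρ j ≡ j
  ρ-positive {j} sj = cong (if_then mirror j else j) sj

  sign-ρ : ∀ j → sign (ρ j) ≡ sign j
  sign-ρ j = bool-cases (sign j)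
    (λ sj → trans (cong sign (ρ-negative sj))
                  (trans (Equivalence.to T-≡ (mirror-sign (T-true sj))) (sym sj)))
    (λ sj → cong sign (ρ-positive sj))

  ρ-involutive : ∀ j → ρ (ρ j) ≡ j
  ρ-involutive j = bool-cases (sign j)
    (λ sj → trans (ρ-negative (trans (sign-ρ j) sj))
                  (trans (cong mirror (ρ-negative sj)) (mirror-involutive (T-true sj))))
    (λ sj → trans (ρ-positive (trans (sign-ρ j) sj)) (ρ-positive sj))

  ρ-reverses : ∀ {a b} → sign a ≡ true → sign b ≡ true → less (ρ a) (ρ b) ≡ less b a
  ρ-reverses {a} {b} sa sb rewrite ρ-negative {a} sa | ρ-negative {b} sb =
    mirror-reverses (T-true sa) (T-true sb)

  toℕ-π : ∀ j → toℕ (π j) ≡ rank (λ _ → true) j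
  toℕ-π j = FinP.toℕ-fromℕ< (rank<n (λ _ → true) j)

  less≡π< : ∀ a b → less a b ≡ ⌊ toℕ (π a) ℕ.<? toℕ (π b) ⌋
  less≡π< a b =
    trans (less≡rank< (λ _ → true) tt tt) (sym (cong₂ (λ r s → ⌊ r ℕ.<? s ⌋) (toℕ-π a) (toℕ-π b)))

  π-injective : Injective _≡_ _≡_ π
  π-injective {a} {b} eq = rank-injective val-injective (λ _ → true) tt tt
    (trans (sym (toℕ-π a)) (trans (cong toℕ eq) (toℕ-π b)))

  Φ-perm : IsSignedPermutation Φ
  Φ-perm {a} {b} eq = begin
    a         ≡⟨ ρ-involutive a ⟨
    ρ (ρ a)   ≡⟨ cong ρ (π-injective eq) ⟩
    ρ (ρ b)   ≡⟨ ρ-involutive b ⟩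
    b         ∎
    where open ≡-Reasoning

  Φ-order : ∀ x y → ⌊ val Φ x ℤ.<? val Φ y ⌋ ≡ signedLess (sign x) (sign y) (less x y)
  Φ-order x y = begin
    ⌊ val Φ x ℤ.<? val Φ y ⌋
      ≡⟨ cong₂ (λ a b → ⌊ a ℤ.<? b ⌋) (val≡signed Φ x) (val≡signed Φ y) ⟩
    ⌊ signed (sign x , π (ρ x)) ℤ.<? signed (sign y , π (ρ y)) ⌋
      ≡⟨ by-signs (sign x) (sign y) refl refl ⟩
    signedLess (sign x) (sign y) (less x y)
      ∎
    where
    open ≡-Reasoning
    by-signs : ∀ sx sy → sign x ≡ sx → sign y ≡ sy →
               ⌊ signed (sx , π (ρ x)) ℤ.<? signed (sy , π (ρ y)) ⌋ ≡ signedLess sx sy (less x y)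
    by-signs false false sx sy = begin
      ⌊ signed (false , π (ρ x)) ℤ.<? signed (false , π (ρ y)) ⌋ ≡⟨ signed-<-positive (π (ρ x)) (π (ρ y)) ⟩
      ⌊ toℕ (π (ρ x)) ℕ.<? toℕ (π (ρ y)) ⌋                       ≡⟨ less≡π< (ρ x) (ρ y) ⟨
      less (ρ x) (ρ y)                                           ≡⟨ cong₂ less (ρ-positive sx) (ρ-positive sy) ⟩
      less x y                                                   ∎
    by-signs true true sx sy = begin
      ⌊ signed (true , π (ρ x)) ℤ.<? signed (true , π (ρ y)) ⌋   ≡⟨ signed-<-negative (π (ρ x)) (π (ρ y)) ⟩
      ⌊ toℕ (π (ρ y)) ℕ.<? toℕ (π (ρ x)) ⌋                       ≡⟨ less≡π< (ρ y) (ρ x) ⟨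
      less (ρ y) (ρ x)                                           ≡⟨ ρ-reverses sy sx ⟩
      less x y                                                   ∎
    by-signs true  false _ _ = signed-<-mixed true  (π (ρ x)) (π (ρ y))
    by-signs false true  _ _ = signed-<-mixed false (π (ρ x)) (π (ρ y))

  less≡Φ-less : ∀ {x y} → sign x ≡ sign y → less x y ≡ ⌊ val Φ x ℤ.<? val Φ y ⌋
  less≡Φ-less {x} {y} same = begin
    less x y                                ≡⟨ signedLess-same (sign x) (less x y) ⟨
    signedLess (sign x) (sign x) (less x y) ≡⟨ cong (λ s → signedLess (sign x) s (less x y)) same ⟩
    signedLess (sign x) (sign y) (less x y) ≡⟨ Φ-order x y ⟨
    ⌊ val Φ x ℤ.<? val Φ y ⌋                ∎
    where open ≡-Reasoning

  negative-beyond : ∀ k → n ≤ k → negative k ≡ false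
  negative-beyond k n≤k = cong parity (suffixCount-beyond switch k n≤k)

  sign≡switch-xor-next : ∀ j → sign j ≡ switch j xor negative (suc (toℕ j))
  sign≡switch-xor-next j = trans (cong parity (suffixCount-toℕ switch j)) (parity-bit+ (switch j) _)

  switch≡sign-xor-next : ∀ j → switch j ≡ sign j xor negative (suc (toℕ j))
  switch≡sign-xor-next j =
    sym (trans (cong (_xor negative (suc (toℕ j))) (sign≡switch-xor-next j)) (xor-cancelʳ _ _))

  Φ-descent : ∀ j → isDes Φ j ≡ signedLess (negative (suc (toℕ j))) (sign j) (isDes σ j)
  Φ-descent j = [ last , interior ]′ (≤-<-connex n (suc (toℕ j)))
    where
    open ≡-Reasoning

    last : n ≤ suc (toℕ j) → isDes Φ j ≡ signedLess (negative (suc (toℕ j))) (sign j) (isDes σ j)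
    last n≤j+1 = begin
      isDes Φ j
        ≡⟨ ⟨⟩-beyond _ _ n≤j+1 ⟩
      false
        ≡⟨ signedLess-false (sign j) ⟨
      signedLess false (sign j) false
        ≡⟨ cong₂ (λ s b → signedLess s (sign j) b) (negative-beyond _ n≤j+1) (⟨⟩-beyond _ _ n≤j+1) ⟨
      signedLess (negative (suc (toℕ j))) (sign j) (isDes σ j)
        ∎

    interior : suc (toℕ j) < n → isDes Φ j ≡ signedLess (negative (suc (toℕ j))) (sign j) (isDes σ j)
    interior j+1<n = begin
      isDes Φ j
        ≡⟨ at-next (λ x → ⌊ val Φ x ℤ.<? val Φ j ⌋) ⟩
      ⌊ val Φ j′ ℤ.<? val Φ j ⌋
        ≡⟨ Φ-order j′ j ⟩
      signedLess (sign j′) (sign j) (less j′ j)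
        ≡⟨ cong₂ (λ s b → signedLess s (sign j) b) (cong negative next) (sym (at-next (λ x → less x j))) ⟩
      signedLess (negative (suc (toℕ j))) (sign j) (isDes σ j)
        ∎
      where
      j′ = Fin.fromℕ< j+1<n
      next : toℕ j′ ≡ suc (toℕ j)
      next = FinP.toℕ-fromℕ< j+1<n
      at-next : ∀ P → P ⟨ suc (toℕ j) ⟩ ≡ P j′
      at-next P = trans (cong (P ⟨_⟩) (sym next)) (⟨⟩-toℕ P j′)

  Φ-weight : ∀ i → d i σ + nNeg i (inverse σ) ≡ 2 * d i Φ + ε i Φ
  Φ-weight i = suffixCount-telescope (isDes σ) (isNeg (inverse σ)) (isDes Φ) negative negative-beyond
                 local (toℕ i)
    where
    local : ∀ j → bit (isDes σ j) + bit (isNeg (inverse σ) j) + bit (negative (suc (toℕ j)))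
                  ≡ 2 * bit (isDes Φ j) + bit (sign j)
    local j = begin
      bit D + bit S + bit m′
        ≡⟨ signedLess-balance D S m′ ⟩
      2 * bit (signedLess m′ (switch j xor m′) D) + bit (switch j xor m′)
        ≡⟨ cong (λ s → 2 * bit (signedLess m′ s D) + bit s) (sign≡switch-xor-next j) ⟨
      2 * bit (signedLess m′ (sign j) D) + bit (sign j)
        ≡⟨ cong (λ e → 2 * bit e + bit (sign j)) (Φ-descent j) ⟨
      2 * bit (isDes Φ j) + bit (sign j)
        ∎
      where
      open ≡-Reasoning
      D = isDes σ j
      S = isNeg (inverse σ) j
      m′ = negative (suc (toℕ j))

open Construction using (Φ)

module _ {n} {σ τ : SignedMap n} (σ-perm : IsSignedPermutation σ) (τ-perm : IsSignedPermutation τ) where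

  -- Neg(σ⁻¹) fixes the set of values of σ, and σ(j) is the value whose rank in that set is the
  -- rank of σ(j) among the entries of σ.
  signedPermutation-ext : (∀ a → isNeg (inverse σ) a ≡ isNeg (inverse τ) a) →
                          (∀ x y → Rank.less (val σ) x y ≡ Rank.less (val τ) x y) → σ ≗ τ
  signedPermutation-ext neg≡ less≡ j = begin
    σ j
      ≡⟨ cong (_, proj₂ (σ j)) (inverse-sign σ σ-perm j) ⟨
    (isNeg (inverse σ) (proj₂ (σ j)) , proj₂ (σ j))
      ≡⟨ cong (λ a → isNeg (inverse σ) a , a) abs≡ ⟩
    (isNeg (inverse σ) (proj₂ (τ j)) , proj₂ (τ j))
      ≡⟨ cong (_, proj₂ (τ j)) (trans (neg≡ _) (inverse-sign τ τ-perm j)) ⟩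
    τ j
      ∎
    where
    open ≡-Reasoning

    w : Fin n → ℤ
    w a = signed (isNeg (inverse σ) a , a)

    w-injective : Injective _≡_ _≡_ w
    w-injective = cong proj₂ ∘ signed-injective

    val-σ : ∀ x → val σ x ≡ w (proj₂ (σ x))
    val-σ x = trans (val≡signed σ x)
                    (cong (λ s → signed (s , proj₂ (σ x))) (sym (inverse-sign σ σ-perm x)))

    val-τ : ∀ x → val τ x ≡ w (proj₂ (τ x))
    val-τ x = trans (val≡signed τ x)
                    (cong (λ s → signed (s , proj₂ (τ x))) (sym (trans (neg≡ _) (inverse-sign τ τ-perm x))))

    everywhere : Fin n → Bool
    everywhere _ = true

    abs≡ : proj₂ (σ j) ≡ proj₂ (τ j)
    abs≡ = Rank.rank-injective w w-injective everywhere tt tt (begin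
      Rank.rank w everywhere (proj₂ (σ j)) ≡⟨ rank-reindex σ-perm val-σ everywhere j ⟨
      Rank.rank (val σ) everywhere j       ≡⟨ count-cong (allFin n) (λ x → less≡ x j) ⟩
      Rank.rank (val τ) everywhere j       ≡⟨ rank-reindex τ-perm val-τ everywhere j ⟩
      Rank.rank w everywhere (proj₂ (τ j)) ∎)

  module Recovery (Φ≗ : Φ σ ≗ Φ τ) where

    module Cσ = Construction σ
    module Cτ = Construction τ
    module Pσ = ConstructionProperties σ σ-perm
    module Pτ = ConstructionProperties τ τ-perm

    sign≡ : ∀ j → Cσ.sign j ≡ Cτ.sign j
    sign≡ j = cong proj₁ (Φ≗ j)

    sign-τ : ∀ {j b} → Cσ.sign j ≡ b → Cτ.sign j ≡ b
    sign-τ {j} = trans (sym (sign≡ j))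

    less≡-same-sign : ∀ {x y} → Cσ.sign x ≡ Cσ.sign y → Cσ.less x y ≡ Cτ.less x y
    less≡-same-sign {x} {y} same = begin
      Cσ.less x y                      ≡⟨ Pσ.less≡Φ-less same ⟩
      ⌊ val Cσ.Φ x ℤ.<? val Cσ.Φ y ⌋   ≡⟨ cong₂ (λ a b → ⌊ a ℤ.<? b ⌋) (val-Φ≡ x) (val-Φ≡ y) ⟩
      ⌊ val Cτ.Φ x ℤ.<? val Cτ.Φ y ⌋   ≡⟨ Pτ.less≡Φ-less (sign-τ (trans same (sign≡ y))) ⟨
      Cτ.less x y                      ∎
      where
      open ≡-Reasoning
      val-Φ≡ : ∀ x → val Cσ.Φ x ≡ val Cτ.Φ x
      val-Φ≡ x = trans (val≡signed Cσ.Φ x) (trans (cong signed (Φ≗ x)) (sym (val≡signed Cτ.Φ x)))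

    rank-sign≡ : ∀ {j} → Cσ.sign j ≡ true → Cσ.rank Cσ.sign j ≡ Cτ.rank Cτ.sign j
    rank-sign≡ {j} sj = count-cong (allFin n) λ x → bool-cases (Cσ.sign x)
      (λ sx → cong₂ _∧_ (sign≡ x) (less≡-same-sign (trans sx (sym sj))))
      (λ sx → trans (cong (_∧ Cσ.less x j) sx) (sym (cong (_∧ Cτ.less x j) (sign-τ sx))))

    K≡ : Cσ.K ≡ Cτ.K
    K≡ = count-cong (allFin n) sign≡

    mirror≡ : ∀ {j} → Cσ.sign j ≡ true → Cσ.mirror j ≡ Cτ.mirror j
    mirror≡ {j} sj = Cτ.rank-injective Pτ.val-injective Cτ.sign
      (subst T (sign≡ (Cσ.mirror j)) (Pσ.mirror-sign (T-true sj)))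
      (Pτ.mirror-sign (T-true (sign-τ sj))) (begin
        Cτ.rank Cτ.sign (Cσ.mirror j)    ≡⟨ rank-sign≡ (Equivalence.to T-≡ (Pσ.mirror-sign (T-true sj))) ⟨
        Cσ.rank Cσ.sign (Cσ.mirror j)    ≡⟨ Pσ.rank-mirror (T-true sj) ⟩
        Cσ.K ∸ suc (Cσ.rank Cσ.sign j)   ≡⟨ cong₂ (λ k r → k ∸ suc r) K≡ (rank-sign≡ sj) ⟩
        Cτ.K ∸ suc (Cτ.rank Cτ.sign j)   ≡⟨ Pτ.rank-mirror (T-true (sign-τ sj)) ⟨
        Cτ.rank Cτ.sign (Cτ.mirror j)    ∎)
      where open ≡-Reasoning

    ρ≡ : ∀ j → Cσ.ρ j ≡ Cτ.ρ j
    ρ≡ j = bool-cases (Cσ.sign j)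
      (λ sj → trans (Pσ.ρ-negative sj) (trans (mirror≡ sj) (sym (Pτ.ρ-negative (sign-τ sj)))))
      (λ sj → trans (Pσ.ρ-positive sj) (sym (Pτ.ρ-positive (sign-τ sj))))

    π≡ : ∀ j → Cσ.π j ≡ Cτ.π j
    π≡ j = begin
      Cσ.π j                 ≡⟨ cong Cσ.π (Pσ.ρ-involutive j) ⟨
      proj₂ (Cσ.Φ (Cσ.ρ j))  ≡⟨ cong proj₂ (Φ≗ (Cσ.ρ j)) ⟩
      proj₂ (Cτ.Φ (Cσ.ρ j))  ≡⟨ cong (proj₂ ∘ Cτ.Φ) (ρ≡ j) ⟩
      Cτ.π (Cτ.ρ (Cτ.ρ j))   ≡⟨ cong Cτ.π (Pτ.ρ-involutive j) ⟩
      Cτ.π j                 ∎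
      where open ≡-Reasoning

    less≡ : ∀ x y → Cσ.less x y ≡ Cτ.less x y
    less≡ x y = trans (Pσ.less≡π< x y)
                      (trans (cong₂ (λ a b → ⌊ toℕ a ℕ.<? toℕ b ⌋) (π≡ x) (π≡ y)) (sym (Pτ.less≡π< x y)))

    negative≡ : ∀ k → Cσ.negative k ≡ Cτ.negative k
    negative≡ k = [ beyond , inside ]′ (≤-<-connex n k)
      where
      beyond : n ≤ k → Cσ.negative k ≡ Cτ.negative k
      beyond n≤k = trans (Pσ.negative-beyond k n≤k) (sym (Pτ.negative-beyond k n≤k))
      inside : k < n → Cσ.negative k ≡ Cτ.negative k
      inside k<n =
        subst (λ k → Cσ.negative k ≡ Cτ.negative k) (FinP.toℕ-fromℕ< k<n) (sign≡ (Fin.fromℕ< k<n))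

    neg≡ : ∀ a → isNeg (inverse σ) a ≡ isNeg (inverse τ) a
    neg≡ a = begin
      isNeg (inverse σ) a         ≡⟨ xor-cancelˡ (isDes σ a) _ ⟨
      isDes σ a xor Cσ.switch a   ≡⟨ cong₂ _xor_ (isDes≡ a) switch≡ ⟩
      isDes τ a xor Cτ.switch a   ≡⟨ xor-cancelˡ (isDes τ a) _ ⟩
      isNeg (inverse τ) a         ∎
      where
      open ≡-Reasoning
      isDes≡ : ∀ j → isDes σ j ≡ isDes τ j
      isDes≡ j = ⟨⟩-cong (λ x → less≡ x j) (suc (toℕ j))
      switch≡ : Cσ.switch a ≡ Cτ.switch a
      switch≡ = trans (Pσ.switch≡sign-xor-next a)
        (trans (cong₂ _xor_ (sign≡ a) (negative≡ (suc (toℕ a)))) (sym (Pτ.switch≡sign-xor-next a)))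

  Φ-injective : Φ σ ≗ Φ τ → σ ≗ τ
  Φ-injective Φ≗ = signedPermutation-ext neg≡ less≡
    where open Recovery Φ≗

_∈≗_ : ∀ {A : Set} {m} → (Fin m → A) → List (Fin m → A) → Set
_∈≗_ {A} {m} = SetoidMembership._∈_ (Fin m →-setoid A)

module _ {A : Set} (vs : List A) where

  private
    FunSetoid : ℕ → Setoid _ _
    FunSetoid m = Fin m →-setoid A

  allFuns-complete : ∀ m (f : Fin m → A) → (∀ i → f i ∈ vs) → f ∈≗ allFuns vs m
  allFuns-complete zero    f _  = here (λ ())
  allFuns-complete (suc m) f f∈ =
    SetoidMembershipP.∈-concatMap⁺ (setoid A) (FunSetoid (suc m)) (Any.map with-head (f∈ Fin.zero))
    where
    with-head : ∀ {x} → f Fin.zero ≡ x → f ∈≗ map (x ∷ᶠ_) (allFuns vs m)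
    with-head refl = SetoidMembershipP.∈-resp-≈ (FunSetoid (suc m)) (λ { Fin.zero → refl ; (Fin.suc i) → refl })
      (SetoidMembershipP.∈-map⁺ (FunSetoid m) (FunSetoid (suc m))
        (λ g≗h → λ { Fin.zero → refl ; (Fin.suc i) → g≗h i })
        (allFuns-complete m (f ∘ Fin.suc) (f∈ ∘ Fin.suc)))

  allFuns-unique : Unique vs → ∀ m → SetoidUnique.Unique (FunSetoid m) (allFuns vs m)
  allFuns-unique vs! zero    = All.[] AllPairs.∷ AllPairs.[]
  allFuns-unique vs! (suc m) = SetoidUniqueP.concat⁺ (FunSetoid (suc m))
    (AllP.map⁺ (All.universal (λ _ → cons-unique) vs))
    (AllPairsP.map⁺ (AllPairs.map disjoint vs!))
    where
    cons-unique : ∀ {x} → SetoidUnique.Unique (FunSetoid (suc m)) (map (x ∷ᶠ_) (allFuns vs m))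
    cons-unique = SetoidUniqueP.map⁺ (FunSetoid m) (FunSetoid (suc m)) (_∘ Fin.suc) (allFuns-unique vs! m)

    head≡ : ∀ {x} {h : Fin (suc m) → A} {gs} → h ∈≗ map (x ∷ᶠ_) gs → h Fin.zero ≡ x
    head≡ {gs = g ∷ gs} (here h≗)  = h≗ Fin.zero
    head≡ {gs = g ∷ gs} (there h∈) = head≡ h∈

    disjoint : ∀ {x y} → x ≢ y → _
    disjoint x≢y (h∈x , h∈y) = x≢y (trans (sym (head≡ h∈x)) (head≡ h∈y))

signedValues : ∀ n → List (Bool × Fin n)
signedValues n = concatMap (λ b → map (λ k → (b , k)) (allFin n)) (true ∷ false ∷ [])

signedValues-unique : ∀ n → Unique (signedValues n)
signedValues-unique n = Unique.cartesianProduct⁺ bools-unique (Unique.allFin⁺ n)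
  where
  bools-unique : Unique (true ∷ false ∷ [])
  bools-unique = ((λ ()) All.∷ All.[]) AllPairs.∷ All.[] AllPairs.∷ AllPairs.[]

∈-signedValues : ∀ {n} (x : Bool × Fin n) → x ∈ signedValues n
∈-signedValues (true  , k) = ∈-cartesianProduct⁺ {xs = true ∷ false ∷ []} (here refl) (∈-allFin k)
∈-signedValues (false , k) = ∈-cartesianProduct⁺ {xs = true ∷ false ∷ []} (there (here refl)) (∈-allFin k)

isBij-sound : ∀ {n} {σ : SignedMap n} → T (isBij σ) → IsSignedPermutation σ
isBij-sound {n} {σ} h {i} {j} eq = [ toWitness , (λ differ → ⊥-elim (toWitnessFalse differ eq)) ]′
  (Equivalence.to (T-∨ {⌊ i FinP.≟ j ⌋}) pair)
  where
  row : T (all (λ j → ⌊ i FinP.≟ j ⌋ ∨ not ⌊ proj₂ (σ i) FinP.≟ proj₂ (σ j) ⌋) (allFin n))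
  row = All.lookup (AllP.all⁺ _ (allFin n) h) (∈-allFin i)
  pair : T (⌊ i FinP.≟ j ⌋ ∨ not ⌊ proj₂ (σ i) FinP.≟ proj₂ (σ j) ⌋)
  pair = All.lookup (AllP.all⁺ _ (allFin n) row) (∈-allFin j)

isBij-complete : ∀ {n} {σ : SignedMap n} → IsSignedPermutation σ → T (isBij σ)
isBij-complete {n} {σ} σ-perm =
  AllP.all⁻ _ (All.universal (λ i → AllP.all⁻ _ (All.universal (pair i) (allFin n))) (allFin n))
  where
  pair : ∀ i j → T (⌊ i FinP.≟ j ⌋ ∨ not ⌊ proj₂ (σ i) FinP.≟ proj₂ (σ j) ⌋)
  pair i j with i FinP.≟ j | proj₂ (σ i) FinP.≟ proj₂ (σ j)
  ... | yes _   | _      = tt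
  ... | no  i≢j | yes eq = i≢j (σ-perm eq)
  ... | no  _   | no  _  = tt

module _ {n : ℕ} where

  private
    isBij? : (σ : SignedMap n) → Dec (isBij σ ≡ true)
    isBij? σ = isBij σ Bool.≟ true

  Bn-sound : ∀ {σ} → σ ∈ Bn n → IsSignedPermutation σ
  Bn-sound {σ} σ∈ =
    isBij-sound {σ = σ} (T-true (proj₂ (∈-filter⁻ isBij? {xs = allFuns (signedValues n) n} σ∈)))

  Bn-complete : ∀ {σ} → IsSignedPermutation σ → σ ∈≗ Bn n
  Bn-complete {σ} σ-perm = SetoidMembershipP.∈-filter⁺ (SignedMaps n) isBij? isBij-resp
    (allFuns-complete (signedValues n) n σ (∈-signedValues ∘ σ))
    (Equivalence.to T-≡ (isBij-complete {σ = σ} σ-perm))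
    where
    isBij-resp : ∀ {σ τ} → σ ≗ τ → isBij σ ≡ true → isBij τ ≡ true
    isBij-resp {σ} {τ} σ≗τ h = Equivalence.to T-≡
      (isBij-complete {σ = τ} (signedPermutation-resp-≗ σ≗τ (isBij-sound {σ = σ} (T-true h))))

  Bn-unique : SetoidUnique.Unique (SignedMaps n) (Bn n)
  Bn-unique = SetoidUniqueP.filter⁺ (SignedMaps n) isBij?
    (allFuns-unique (signedValues n) (signedValues-unique n) n)

  open import Data.List.Relation.Binary.Permutation.Setoid (SignedMaps n) using (_↭_)

  Φ-permutes-Bn : map Φ (Bn n) ↭ Bn n
  Φ-permutes-Bn = unique-⊆-length⇒↭ (SignedMaps n)
    (unique-map⁺-on (SignedMaps n) (SignedMaps n) (All.tabulate Bn-sound)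
      (λ {σ} {τ} → Φ-injective {σ = σ} {τ = τ}) Bn-unique)
    image⊆Bn (length-map Φ (Bn n))
    where
    image⊆Bn : ∀ {τ} → τ ∈≗ map Φ (Bn n) → τ ∈≗ Bn n
    image⊆Bn τ∈ = let σ , σ∈ , τ≗Φσ = find (AnyP.map⁻ τ∈) in
      SetoidMembershipP.∈-resp-≈ (SignedMaps n) (λ i → sym (τ≗Φσ i))
        (Bn-complete (ConstructionProperties.Φ-perm σ (Bn-sound σ∈)))

d-resp-≗ : ∀ {n} {σ τ : SignedMap n} → σ ≗ τ → ∀ i → d i σ ≡ d i τ
d-resp-≗ {n} {σ} {τ} σ≗τ i = count-cong (allFin n) λ j → cong (⌊ toℕ i ℕ.≤? toℕ j ⌋ ∧_) (isDes-resp j)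
  where
  isDes-resp : ∀ j → isDes σ j ≡ isDes τ j
  isDes-resp j = ⟨⟩-cong (λ x → cong₂ (λ a b → ⌊ a ℤ.<? b ⌋) (val-resp-≗ σ≗τ x) (val-resp-≗ σ≗τ j)) (suc (toℕ j))

ε-resp-≗ : ∀ {n} {σ τ : SignedMap n} → σ ≗ τ → ∀ i → ε i σ ≡ ε i τ
ε-resp-≗ σ≗τ i = cong (bit ∘ proj₁) (σ≗τ i)

module _ {c ℓ} (R : CommutativeSemiring c ℓ) {n : ℕ} where

  open CommutativeSemiring R using (Carrier; _≈_; 1#; +-isCommutativeMonoid)
    renaming (setoid to R-setoid; _*_ to _*ᴿ_)
  open import Data.List.Relation.Binary.Permutation.Setoid.Properties (SignedMaps n) using (map⁺)
  open import Data.List.Relation.Binary.Permutation.Setoid.Properties R-setoid using (foldr-commMonoid)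

  prodF-cong : ∀ {f g : Fin n → Carrier} → (∀ i → f i ≡ g i) → prodF R n f ≡ prodF R n g
  prodF-cong f≗g = cong (foldr _*ᴿ_ 1#) (map-cong f≗g (allFin n))

  sum-Bn-∘Φ : (f : SignedMap n → Carrier) → (∀ {σ τ} → σ ≗ τ → f σ ≈ f τ) →
              sumL R (map (f ∘ Φ) (Bn n)) ≈ sumL R (map f (Bn n))
  sum-Bn-∘Φ f f-resp = begin
    sumL R (map (f ∘ Φ) (Bn n))
      ≡⟨ cong (sumL R) (map-∘ (Bn n)) ⟩
    sumL R (map f (map Φ (Bn n)))
      ≈⟨ foldr-commMonoid +-isCommutativeMonoid (map⁺ R-setoid f-resp Φ-permutes-Bn) ⟩
    sumL R (map f (Bn n))
      ∎
    where open ≈-Reasoning R-setoid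

theorem6p1 : ∀ {c ℓ : Level} (R : CommutativeSemiring c ℓ) (n : ℕ) → 1 ≤ n →
    (q : Fin n → CommutativeSemiring.Carrier R) →
    CommutativeSemiring._≈_ R
      (genFun R n q (λ i σ → d i σ + nNeg i (inverse σ)))
      (genFun R n q (λ i σ → 2 * d i σ + ε i σ))
theorem6p1 R n _ q = begin
  sumL R (map leftWeight (Bn n))          ≡⟨ cong (sumL R) (map-cong-local (All.tabulate left≡right∘Φ)) ⟩
  sumL R (map (rightWeight ∘ Φ) (Bn n))   ≈⟨ sum-Bn-∘Φ R rightWeight rightWeight-resp-≗ ⟩
  sumL R (map rightWeight (Bn n))         ∎
  where
  open CommutativeSemiring R using (Carrier; _≈_; reflexive) renaming (setoid to R-setoid)
  open ≈-Reasoning R-setoid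

  weight : (Fin n → SignedMap n → ℕ) → SignedMap n → Carrier
  weight e σ = prodF R n (λ i → pow R (q i) (e i σ))

  leftWeight rightWeight : SignedMap n → Carrier
  leftWeight  = weight (λ i σ → d i σ + nNeg i (inverse σ))
  rightWeight = weight (λ i σ → 2 * d i σ + ε i σ)

  exponents-cong : ∀ {e f : Fin n → ℕ} → (∀ i → e i ≡ f i) →
                   prodF R n (λ i → pow R (q i) (e i)) ≡ prodF R n (λ i → pow R (q i) (f i))
  exponents-cong e≗f = prodF-cong R (λ i → cong (pow R (q i)) (e≗f i))

  left≡right∘Φ : ∀ {σ} → σ ∈ Bn n → leftWeight σ ≡ rightWeight (Φ σ)
  left≡right∘Φ {σ} σ∈ = exponents-cong (ConstructionProperties.Φ-weight σ (Bn-sound σ∈))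

  rightWeight-resp-≗ : ∀ {σ τ} → σ ≗ τ → rightWeight σ ≈ rightWeight τ
  rightWeight-resp-≗ σ≗τ =
    reflexive (exponents-cong λ i → cong₂ (λ a b → 2 * a + b) (d-resp-≗ σ≗τ i) (ε-resp-≗ σ≗τ i))
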